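{- Let $S$ be a string of length $n$ in which every character occurs at least twice, let $\sigma$ be a character of $S$ occurring $\ell\ge 2$ times, at positions $i_1<\dots<i_\ell$, and let $e=\lfloor \ell/2\rfloor$. Let $Y$ be any maximal common subsequence of $S[i_1,i_{e+1})$ and $S[i_{e+1},n]$ containing $\sigma^e$; if $\ell$ is odd and $Y$ is a subsequence of $S[i_{e+2},n]$, replace $Y$ by any maximal common subsequence of $S[i_1,i_{e+2})$ and $S[i_{e+2},n]$ containing the old $Y$. Let $j_1$ be the smallest index such that $Y$ is a subsequence of $S[i_1,j_1]$, and let $Z$ be any maximal common subsequence of $S[1,j_1]$ and $S(j_1,n]$ containing $Y$. If $\ell$ is odd, let $j_2$ be the smallest index such that $Y$ is a subsequence of $S[i_2,j_2]$, and if moreover $Z$ is a subsequence of $S(j_2,n]$, replace $Z$ by any maximal common subsequence of $S[1,j_2]$ and $S(j_2,n]$ containing the old $Z$. Then $X_2=ZZ$ is not inner-extendable.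
   Context: For a string $S$, $S[i,j]=S[i]\cdots S[j]$ (empty if $j<i$), $S[i,j)=S[i,j-1]$, $S(i,j]=S[i+1,j]$; $\sigma^e$ is $e$ copies of $\sigma$. A common subsequence $C$ of $S_1,S_2$ is maximal if no common subsequence of $S_1,S_2$ properly contains it. A square subsequence $WW$ of $S$ is inner-extendable if there is a character $y$ and a factorization $W=W_1W_2$ with $W_1,W_2$ both nonempty such that $W_1yW_2W_1yW_2$ is a subsequence of $S$. -}

module Defs where

open import Level using (Level)
open import Data.Nat.Base using (ℕ; zero; suc; _+_; _*_; _∸_; _≤_; _<_)
open import Data.List.Base using (List; []; _∷_; _++_; take; drop; length)
open import Data.List.Relation.Binary.Sublist.Propositional using (_⊆_)
open import Data.Product using (Σ; ∃; _×_)
open import Data.Sum using (_⊎_)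
open import Data.Empty using (⊥)
open import Relation.Binary.PropositionalEquality using (_≡_; _≢_)
open import Relation.Nullary using (¬_)

module _ {A : Set} where

  -- Positions are 1-indexed, as in the paper.
  -- At S p c : the p-th character of S (1-indexed) exists and equals c.
  At : List A → ℕ → A → Set
  At []       _             _ = ⊥
  At (x ∷ xs) zero          _ = ⊥
  At (x ∷ xs) (suc zero)    c = x ≡ c
  At (x ∷ xs) (suc (suc p)) c = At xs (suc p) c

  -- S[i,j] = S[i] ... S[j]   (empty if j < i)
  seg : List A → ℕ → ℕ → List A
  seg S i j = take (suc j ∸ i) (drop (i ∸ 1) S)

  -- S[i,j) = S[i,j-1]   (for i ≥ 1)
  segCO : List A → ℕ → ℕ → List A
  segCO S i j = take (j ∸ i) (drop (i ∸ 1) S)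

  -- S(i,j] = S[i+1,j]
  segOC : List A → ℕ → ℕ → List A
  segOC S i j = take (j ∸ i) (drop i S)

  CommonSub : List A → List A → List A → Set
  CommonSub C S₁ S₂ = (C ⊆ S₁) × (C ⊆ S₂)

  MaxCommonSub : List A → List A → List A → Set
  MaxCommonSub C S₁ S₂ =
    CommonSub C S₁ S₂ × (∀ C′ → CommonSub C′ S₁ S₂ → C ⊆ C′ → C′ ≡ C)

  EveryCharTwice : List A → Set
  EveryCharTwice S = ∀ p c → At S p c → ∃ λ q → (q ≢ p) × At S q c

  Occurrences : List A → A → ℕ → (ℕ → ℕ) → Set
  Occurrences S σ ℓ i =
    (∀ k → 1 ≤ k → k < ℓ → i k < i (suc k)) ×
    (∀ k → 1 ≤ k → k ≤ ℓ → At S (i k) σ) ×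
    (∀ p → At S p σ → ∃ λ k → (1 ≤ k) × (k ≤ ℓ) × (i k ≡ p))

  MinEnd : List A → List A → ℕ → ℕ → Set
  MinEnd Y S a j = (Y ⊆ seg S a j) × (∀ j′ → Y ⊆ seg S a j′ → j ≤ j′)

  InnerExtendable : List A → List A → Set
  InnerExtendable S W =
    ∃ λ (y : A) → ∃ λ (W₁ : List A) → ∃ λ (W₂ : List A) →
      (W₁ ≢ []) × (W₂ ≢ []) × (W ≡ W₁ ++ W₂) ×
      (((W₁ ++ y ∷ W₂) ++ (W₁ ++ y ∷ W₂)) ⊆ S)

IsOdd : ℕ → Set
IsOdd ℓ = ∃ λ k → ℓ ≡ suc (2 * k)

{-# OPTIONS --safe #-}
module Submission where

-- Suppose Z ⊆ U with |U| > |Z| and UU a subsequence of S.  Y starts with σ: otherwise its σᵉ would lie strictly after the start of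
-- its window, which holds too few later occurrences of σ.  So U = P σ R with Y ⊆ σR.
-- Embed PσR PσR in S with both copies of σR starting at occurrences α+1 and β+1 of σ.
-- Each copy contains σᵉ, so e + α ≤ β and e + β ≤ ℓ ≤ 2e+1; hence (α,β) = (0,e), or ℓ
-- is odd, β = e+1 and α ≤ 1.  In each case σR is a common subsequence of the windows
-- defining Y, so maximality forces Y = σR.  Minimality of j (j₁ if α = 0, j₂ if α = 1)
-- then makes PσR a common subsequence of S[1,j] and S(j,n] that strictly extends the
-- maximal Z₀ (resp. Z), a contradiction.

open import Defs
open import Data.Nat.Base using (ℕ; zero; suc; _+_; _*_; _∸_; _≤_; _<_; z≤n; s≤s; ⌊_/2⌋)
open import Data.Nat.Properties
open import Data.List.Base using (List; []; _∷_; _++_; length; replicate)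
open import Data.List.Properties using (take-[]; drop-[]; take-all; length-++-sucʳ)
open import Data.List.Relation.Binary.Sublist.Propositional
  using (_⊆_; _∷_; _∷ʳ_; ⊆-refl; ⊆-trans; ⊆-reflexive; ⊆-antisym; minimum)
open import Data.List.Relation.Binary.Sublist.Propositional.Properties
  using (++⁺; ++⁺ˡ; ++⁺ʳ; length-mono-≤)
open import Data.Product using (∃; ∃₂; _×_; _,_; proj₁; proj₂; map₂)
open import Data.Sum using (_⊎_; inj₁; inj₂)
open import Data.Empty using (⊥; ⊥-elim)
open import Relation.Nullary using (¬_; yes; no)
open import Relation.Binary.PropositionalEquality
  using (_≡_; refl; sym; trans; cong; subst; subst₂)

-- segOC S a b = S(a,b] is the working notion of window: seg S (suc a) b and
-- segCO S (suc a) (suc b) both reduce to it, and At S (suc c) x says that x is the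
-- first character of S(c, b] (for b > c).
module _ {A : Set} where

  segOC-[] : ∀ a b → segOC {A = A} [] a b ≡ []
  segOC-[] a b rewrite drop-[] {A = A} a = take-[] (b ∸ a)

  segOC-++ : ∀ (S : List A) {a c b} → a ≤ c → c ≤ b →
    segOC S a c ++ segOC S c b ≡ segOC S a b
  segOC-++ S       {zero}  {zero}  _         _         = refl
  segOC-++ []      {a}     {c}     {b}       _         _
    rewrite segOC-[] a c | segOC-[] c b | segOC-[] a b = refl
  segOC-++ (x ∷ S) {zero}  {suc c} {suc b} _         (s≤s c≤b) =
    cong (x ∷_) (segOC-++ S z≤n c≤b)
  segOC-++ (x ∷ S) {suc a} {suc c} {suc b} (s≤s a≤c) (s≤s c≤b) =
    segOC-++ S a≤c c≤b

  ⊆-segOC-++ : ∀ {X : List A} S {a c b} → a ≤ c → c ≤ b →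
    X ⊆ segOC S a c ++ segOC S c b → X ⊆ segOC S a b
  ⊆-segOC-++ S a≤c c≤b = subst (_ ⊆_) (segOC-++ S a≤c c≤b)

  segOC-⊆ : ∀ (S : List A) {a a′ b′ b} → a ≤ a′ → b′ ≤ b → segOC S a′ b′ ⊆ segOC S a b
  segOC-⊆ S {a} {a′} {b′} {b} a≤a′ b′≤b with ≤-total a′ b′
  ... | inj₂ b′≤a′ rewrite m≤n⇒m∸n≡0 b′≤a′ = minimum _
  ... | inj₁ a′≤b′ =
    ⊆-segOC-++ S a≤a′ (≤-trans a′≤b′ b′≤b)
      (++⁺ˡ (segOC S a a′) (⊆-segOC-++ S a′≤b′ b′≤b (++⁺ʳ (segOC S b′ b) ⊆-refl)))

  segCO-⊆-seg : ∀ (S : List A) a b → segCO S a b ⊆ seg S a (b ∸ 1)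
  segCO-⊆-seg S a       (suc b) = ⊆-refl
  segCO-⊆-seg S zero    zero    = minimum _
  segCO-⊆-seg S (suc a) zero    = minimum _

  segOC-⊆-segCO : ∀ (S : List A) {a c d} → 1 ≤ a → a ≤ suc c → segOC S c d ⊆ segCO S a (suc d)
  segOC-⊆-segCO S {suc a} {d = d} _ (s≤s a≤c) = segOC-⊆ S {b′ = d} a≤c ≤-refl

  segOC-At : ∀ (S : List A) c {x} → At S (suc c) x → segOC S c (suc c) ≡ x ∷ []
  segOC-At (y ∷ S) zero    refl = refl
  segOC-At (y ∷ S) (suc c) at   = segOC-At S c at

  ∷-⊆-segOC⁻ : ∀ (S : List A) a b {x X} → x ∷ X ⊆ segOC S a b →
    ∃ λ c → a ≤ c × c < b × At S (suc c) x × X ⊆ segOC S (suc c) b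
  ∷-⊆-segOC⁻ [] a b h with subst (_ ⊆_) (segOC-[] a b) h
  ... | ()
  ∷-⊆-segOC⁻ (y ∷ S) zero    (suc b) (x≡y ∷ X⊆) = zero , z≤n , s≤s z≤n , sym x≡y , X⊆
  ∷-⊆-segOC⁻ (y ∷ S) zero    (suc b) (.y ∷ʳ h) with ∷-⊆-segOC⁻ S zero b h
  ... | c , _ , c<b , at , X⊆ = suc c , z≤n , s≤s c<b , at , X⊆
  ∷-⊆-segOC⁻ (y ∷ S) (suc a) (suc b) h with ∷-⊆-segOC⁻ S a b h
  ... | c , a≤c , c<b , at , X⊆ = suc c , s≤s a≤c , s≤s c<b , at , X⊆

  ∷-⊆-seg⁻ : ∀ (S : List A) {a b x X} → x ∷ X ⊆ seg S (suc a) b →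
    suc a ≤ b × X ⊆ segOC S (suc a) b
  ∷-⊆-seg⁻ S {a} {b} h with ∷-⊆-segOC⁻ S a b h
  ... | c , a≤c , c<b , _ , X⊆ =
    ≤-<-trans a≤c c<b , ⊆-trans X⊆ (segOC-⊆ S {b′ = b} (s≤s a≤c) ≤-refl)

  ∷-⊆-segOC⇒< : ∀ (S : List A) {a b x X} → x ∷ X ⊆ segOC S a b → a < b
  ∷-⊆-segOC⇒< S {a} {b} h with ∷-⊆-segOC⁻ S a b h
  ... | _ , a≤c , c<b , _ = ≤-<-trans a≤c c<b

  ∷-⊆-segOC⁺ : ∀ (S : List A) {a c b x X} → a ≤ c → c < b → At S (suc c) x →
    X ⊆ segOC S (suc c) b → x ∷ X ⊆ segOC S a b
  ∷-⊆-segOC⁺ S {a} {c} {b} a≤c c<b at X⊆ =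
    ⊆-segOC-++ S a≤c (<⇒≤ c<b) (++⁺ˡ (segOC S a c)
      (⊆-segOC-++ S (n≤1+n c) c<b
        (subst (λ T → _ ⊆ T ++ segOC S (suc c) b) (sym (segOC-At S c at)) (refl ∷ X⊆))))

  ++-⊆-segOC⁻ : ∀ (S : List A) {a b} X {X′} → a ≤ b → X ++ X′ ⊆ segOC S a b →
    ∃ λ c → a ≤ c × c ≤ b × X ⊆ segOC S a c × X′ ⊆ segOC S c b
  ++-⊆-segOC⁻ S {a} [] a≤b h = a , ≤-refl , a≤b , minimum _ , h
  ++-⊆-segOC⁻ S {a} {b} (x ∷ X) a≤b h with ∷-⊆-segOC⁻ S a b h
  ... | c₀ , a≤c₀ , c₀<b , at , h′ with ++-⊆-segOC⁻ S X c₀<b h′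
  ... | c , c₀<c , c≤b , X⊆ , X′⊆ =
    c , ≤-trans a≤c₀ (<⇒≤ c₀<c) , c≤b , ∷-⊆-segOC⁺ S a≤c₀ c₀<c at X⊆ , X′⊆

  At-positive : ∀ {S : List A} {p x} → At S p x → 1 ≤ p
  At-positive {_ ∷ _} {suc _} _ = s≤s z≤n

  ⊆-∷-split : ∀ {x : A} {X U} → x ∷ X ⊆ U → ∃₂ λ P R → U ≡ P ++ x ∷ R × X ⊆ R
  ⊆-∷-split (u ∷ʳ h) with ⊆-∷-split h
  ... | P , R , refl , X⊆R = u ∷ P , R , refl , X⊆R
  ⊆-∷-split {U = _ ∷ U} (refl ∷ X⊆U) = [] , U , refl , X⊆U

  innerExtendable⇒longer-square : ∀ {S Z : List A} → InnerExtendable S Z →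
    ∃ λ U → Z ⊆ U × length Z < length U × U ++ U ⊆ S
  innerExtendable⇒longer-square (y , W₁ , W₂ , _ , _ , refl , UU) =
    W₁ ++ y ∷ W₂ , ++⁺ ⊆-refl (y ∷ʳ ⊆-refl) ,
    ≤-reflexive (sym (length-++-sucʳ W₁ y W₂)) , UU

  MaxCommonSub-sandwich : ∀ {X Y W S₁ S₂ : List A} → MaxCommonSub X S₁ S₂ →
    CommonSub W S₁ S₂ → X ⊆ Y → Y ⊆ W → Y ≡ W
  MaxCommonSub-sandwich (_ , maximal) W-common X⊆Y Y⊆W =
    ⊆-antisym Y⊆W (subst (_⊆ _) (sym (maximal _ W-common (⊆-trans X⊆Y Y⊆W))) X⊆Y)

  MaxCommonSub-no-longer : ∀ {X U S₁ S₂ : List A} → MaxCommonSub X S₁ S₂ →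
    X ⊆ U → length X < length U → ¬ CommonSub U S₁ S₂
  MaxCommonSub-no-longer (_ , maximal) X⊆U X<U U-common =
    <-irrefl (cong length (sym (maximal _ U-common X⊆U))) X<U

  -- The paper's "if P and X₀ ⊆ S₂, replace X₀ by a maximal common subsequence of
  -- S₁ and S₂ containing it", with X the result.
  MaxExtensionIf : Set → List A → List A → List A → List A → Set
  MaxExtensionIf P X₀ S₁ S₂ X =
    (P × (X₀ ⊆ S₂) × MaxCommonSub X S₁ S₂ × (X₀ ⊆ X)) ⊎ (¬ (P × (X₀ ⊆ S₂)) × (X ≡ X₀))

  MaxExtensionIf-⊇ : ∀ {P X₀ S₁ S₂ X} → MaxExtensionIf P X₀ S₁ S₂ X → X₀ ⊆ X
  MaxExtensionIf-⊇ (inj₁ (_ , _ , _ , X₀⊆X)) = X₀⊆X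
  MaxExtensionIf-⊇ (inj₂ (_ , refl))         = ⊆-refl

  MaxExtensionIf-cases : ∀ {P X₀ S₁ S₂ X} → MaxExtensionIf P X₀ S₁ S₂ X →
    (P × MaxCommonSub X S₁ S₂) ⊎ (X ≡ X₀)
  MaxExtensionIf-cases (inj₁ (p , _ , X-max , _)) = inj₁ (p , X-max)
  MaxExtensionIf-cases (inj₂ (_ , X≡X₀))          = inj₂ X≡X₀

  MaxExtensionIf-max : ∀ {P X₀ S₁ S₂ X} → MaxExtensionIf P X₀ S₁ S₂ X →
    P → X₀ ⊆ S₂ → MaxCommonSub X S₁ S₂
  MaxExtensionIf-max (inj₁ (_ , _ , X-max , _)) _ _   = X-max
  MaxExtensionIf-max (inj₂ (unchanged , _))     p X₀⊆ = ⊥-elim (unchanged (p , X₀⊆))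

  MinEnd-square-commonSub : ∀ {S P R : List A} {x c p d b j} → MinEnd (x ∷ R) S (suc c) j →
    P ⊆ segOC S 0 c → x ∷ R ⊆ segOC S c p → p ≤ d → P ⊆ segOC S p d → x ∷ R ⊆ segOC S d b →
    CommonSub (P ++ x ∷ R) (seg S 1 j) (segOC S j b)
  MinEnd-square-commonSub {S} {c = c} {p} {d} {j = j} (R⊆cj , minimal) P⊆₁ R⊆₁ p≤d P⊆₂ R⊆₂ =
    ⊆-segOC-++ S z≤n (<⇒≤ (∷-⊆-segOC⇒< S {c} {j} R⊆cj)) (++⁺ P⊆₁ R⊆cj) ,
    ⊆-segOC-++ S (≤-trans j≤p p≤d) (<⇒≤ (∷-⊆-segOC⇒< S {d} R⊆₂))
      (++⁺ (⊆-trans P⊆₂ (segOC-⊆ S j≤p ≤-refl)) R⊆₂)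
    where
    j≤p : j ≤ p
    j≤p = minimal p R⊆₁

  record AnchoredSquare (S P : List A) (x : A) (R : List A) : Set where
    field
      c p d : ℕ
      p≤d : p ≤ d
      P⊆₁ : P ⊆ segOC S 0 c
      R⊆₁ : x ∷ R ⊆ segOC S c p
      P⊆₂ : P ⊆ segOC S p d
      R⊆₂ : x ∷ R ⊆ segOC S d (length S)
      x-at₁ : At S (suc c) x
      x-at₂ : At S (suc d) x

  private
    anchor : ∀ S a b {x} {R : List A} → x ∷ R ⊆ segOC S a b →
      ∃ λ c → a ≤ c × At S (suc c) x × x ∷ R ⊆ segOC S c b
    anchor S a b h with ∷-⊆-segOC⁻ S a b h
    ... | c , a≤c , c<b , at , R⊆ = c , a≤c , at , ∷-⊆-segOC⁺ S ≤-refl c<b at R⊆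

  anchoredSquare : ∀ {S P : List A} {x R} → (P ++ x ∷ R) ++ (P ++ x ∷ R) ⊆ S →
    AnchoredSquare S P x R
  anchoredSquare {S} {P} UU
    with ++-⊆-segOC⁻ S (P ++ _) z≤n
           (⊆-trans UU (⊆-reflexive (sym (take-all (length S) S ≤-refl))))
  ... | p , _ , p≤n , first , second
    with ++-⊆-segOC⁻ S P z≤n first | ++-⊆-segOC⁻ S P p≤n second
  ... | c₀ , _ , _ , P⊆₁ , R⊆₁ | d₀ , p≤d₀ , _ , P⊆₂ , R⊆₂
    with anchor S c₀ p R⊆₁ | anchor S d₀ (length S) R⊆₂
  ... | c , c₀≤c , at₁ , R⊆₁′ | d , d₀≤d , at₂ , R⊆₂′ = record
    { c = c ; p = p ; d = d ; p≤d = ≤-trans p≤d₀ d₀≤d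
    ; P⊆₁ = ⊆-trans P⊆₁ (segOC-⊆ S {a = 0} ≤-refl c₀≤c) ; R⊆₁ = R⊆₁′
    ; P⊆₂ = ⊆-trans P⊆₂ (segOC-⊆ S {a = p} ≤-refl d₀≤d) ; R⊆₂ = R⊆₂′
    ; x-at₁ = at₁ ; x-at₂ = at₂ }

n≤1+⌊n/2⌋+⌊n/2⌋ : ∀ n → n ≤ suc (⌊ n /2⌋ + ⌊ n /2⌋)
n≤1+⌊n/2⌋+⌊n/2⌋ zero          = z≤n
n≤1+⌊n/2⌋+⌊n/2⌋ (suc zero)    = s≤s z≤n
n≤1+⌊n/2⌋+⌊n/2⌋ (suc (suc n)) =
  s≤s (s≤s (subst (n ≤_) (sym (+-suc ⌊ n /2⌋ ⌊ n /2⌋)) (n≤1+⌊n/2⌋+⌊n/2⌋ n)))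

IsOdd-1+n+n : ∀ n → IsOdd (suc (n + n))
IsOdd-1+n+n n = n , cong (λ t → suc (n + t)) (sym (+-identityʳ n))

⌊1+2n/2⌋≡n : ∀ n → ⌊ suc (2 * n) /2⌋ ≡ n
⌊1+2n/2⌋≡n zero    = refl
⌊1+2n/2⌋≡n (suc n) = cong suc (trans (cong ⌊_/2⌋ (+-suc n (n + 0))) (⌊1+2n/2⌋≡n n))

IsOdd⇒≡1+⌊n/2⌋+⌊n/2⌋ : ∀ {n} → IsOdd n → n ≡ suc (⌊ n /2⌋ + ⌊ n /2⌋)
IsOdd⇒≡1+⌊n/2⌋+⌊n/2⌋ (k , refl) rewrite ⌊1+2n/2⌋≡n k | +-identityʳ k = refl

half-offsets : ∀ {e α β ℓ} → e + α ≤ β → e + β ≤ ℓ → ℓ ≤ suc (e + e) →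
  (α ≡ 0 × β ≡ e) ⊎ (ℓ ≡ suc (e + e) × β ≡ suc e × α ≤ 1)
half-offsets {e} {α} {β} {ℓ} e+α≤β e+β≤ℓ ℓ≤ with m≤n⇒m<n∨m≡n β≤1+e
  where
  β≤1+e : β ≤ suc e
  β≤1+e = +-cancelˡ-≤ e β (suc e) (≤-trans e+β≤ℓ (≤-trans ℓ≤ (≤-reflexive (sym (+-suc e e)))))
... | inj₁ (s≤s β≤e) =
  inj₁ (n≤0⇒n≡0 (+-cancelˡ-≤ e α 0
          (≤-trans e+α≤β (≤-trans β≤e (≤-reflexive (sym (+-identityʳ e)))))) ,
        ≤-antisym β≤e (≤-trans (m≤m+n e α) e+α≤β))
... | inj₂ refl =
  inj₂ (≤-antisym ℓ≤ (subst (_≤ ℓ) (+-suc e e) e+β≤ℓ) , refl ,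
        +-cancelˡ-≤ e α 1 (≤-trans e+α≤β (≤-reflexive (+-comm 1 e))))

module OccurrencesProperties {A : Set} {S : List A} {σ : A} {ℓ : ℕ} {i : ℕ → ℕ}
  (occ : Occurrences S σ ℓ i) where

  private
    i-increasing : ∀ k → 1 ≤ k → k < ℓ → i k < i (suc k)
    i-increasing = proj₁ occ

    σ-at : ∀ k → 1 ≤ k → k ≤ ℓ → At S (i k) σ
    σ-at = proj₁ (proj₂ occ)

    index-of : ∀ p → At S p σ → ∃ λ k → 1 ≤ k × k ≤ ℓ × i k ≡ p
    index-of = proj₂ (proj₂ occ)

  i-strict : ∀ {k k′} → 1 ≤ k → k < k′ → k′ ≤ ℓ → i k < i k′
  i-strict {k} {suc k′} 1≤k (s≤s k≤k′) k′<ℓ with m≤n⇒m<n∨m≡n k≤k′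
  ... | inj₁ k<k′ =
    <-trans (i-strict 1≤k k<k′ (<⇒≤ k′<ℓ)) (i-increasing k′ (≤-trans 1≤k (<⇒≤ k<k′)) k′<ℓ)
  ... | inj₂ refl = i-increasing k 1≤k k′<ℓ

  i-mono : ∀ {k k′} → 1 ≤ k → k ≤ k′ → k′ ≤ ℓ → i k ≤ i k′
  i-mono 1≤k k≤k′ k′≤ℓ with m≤n⇒m<n∨m≡n k≤k′
  ... | inj₁ k<k′ = <⇒≤ (i-strict 1≤k k<k′ k′≤ℓ)
  ... | inj₂ refl = ≤-refl

  i-positive : ∀ {k} → 1 ≤ k → k ≤ ℓ → 1 ≤ i k
  i-positive 1≤k k≤ℓ = At-positive {S = S} (σ-at _ 1≤k k≤ℓ)

  index-of-suc : ∀ {a} → At S (suc a) σ → ∃ λ k → suc k ≤ ℓ × i (suc k) ≡ suc a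
  index-of-suc at with index-of _ at
  ... | suc k , _ , k<ℓ , ik≡ = k , k<ℓ , ik≡

  -- FirstWithin a k: the first k occurrences of σ lie in S[1,a].  Unlike i k ≤ a,
  -- this is meaningful (and trivially true) for k = 0.
  FirstWithin : ℕ → ℕ → Set
  FirstWithin a k = k ≤ ℓ × (∀ k′ → 1 ≤ k′ → k′ ≤ k → i k′ ≤ a)

  FirstWithin-mono : ∀ {a b k} → a ≤ b → FirstWithin a k → FirstWithin b k
  FirstWithin-mono a≤b (k≤ℓ , within) =
    k≤ℓ , λ k′ 1≤k′ k′≤k → ≤-trans (within k′ 1≤k′ k′≤k) a≤b

  FirstWithin-≤ : ∀ {a k k′} → k′ ≤ k → FirstWithin a k → FirstWithin a k′
  FirstWithin-≤ k′≤k (k≤ℓ , within) =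
    ≤-trans k′≤k k≤ℓ , λ k″ 1≤k″ k″≤k′ → within k″ 1≤k″ (≤-trans k″≤k′ k′≤k)

  FirstWithin-at : ∀ {k} → k ≤ ℓ → FirstWithin (i k) k
  FirstWithin-at k≤ℓ = k≤ℓ , λ k′ 1≤k′ k′≤k → i-mono 1≤k′ k′≤k k≤ℓ

  FirstWithin-before : ∀ {a k} → suc k ≤ ℓ → i (suc k) ≡ suc a → FirstWithin a k
  FirstWithin-before k<ℓ ik≡ =
    <⇒≤ k<ℓ , λ k′ 1≤k′ k′≤k → ≤-pred (subst (i k′ <_) ik≡ (i-strict 1≤k′ (s≤s k′≤k) k<ℓ))

  FirstWithin-< : ∀ {a k k′} → FirstWithin a k → 1 ≤ k′ → k′ ≤ ℓ → a < i k′ → k < k′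
  FirstWithin-< {k = k} {k′} (_ , within) 1≤k′ _ a<ik′ with k′ ≤? k
  ... | yes k′≤k = ⊥-elim (<⇒≱ a<ik′ (within k′ 1≤k′ k′≤k))
  ... | no  k′≰k = ≰⇒> k′≰k

  ¬FirstWithin-pred : ∀ {k} → 1 ≤ k → ¬ FirstWithin (i k ∸ 1) k
  ¬FirstWithin-pred {k} 1≤k (k≤ℓ , within)
    with i k | i-positive 1≤k k≤ℓ | within k 1≤k ≤-refl
  ... | suc a | _ | 1+a≤a = 1+n≰n 1+a≤a

  FirstWithin-replicate : ∀ {a b k} m → a ≤ b → FirstWithin a k →
    replicate m σ ⊆ segOC S a b → FirstWithin b (m + k)
  FirstWithin-replicate zero a≤b first _ = FirstWithin-mono a≤b first
  FirstWithin-replicate {a} {b} {k} (suc m) _ first h with ∷-⊆-segOC⁻ S a b h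
  ... | c , a≤c , c<b , at , h′ with index-of _ at
  ... | k₁ , 1≤k₁ , k₁≤ℓ , ik₁≡ =
    FirstWithin-≤ (subst (_≤ m + k₁) (+-suc m k) (+-monoʳ-≤ m k<k₁))
      (FirstWithin-replicate m c<b
        (subst (λ q → FirstWithin q k₁) ik₁≡ (FirstWithin-at k₁≤ℓ)) h′)
    where
    k<k₁ : k < k₁
    k<k₁ = FirstWithin-< first 1≤k₁ k₁≤ℓ (subst (a <_) (sym ik₁≡) (s≤s a≤c))

  replicate-head : ∀ {m p k b X} → 1 ≤ m → 1 ≤ p → FirstWithin p k →
    ¬ FirstWithin b (m + k) → replicate m σ ⊆ X → X ⊆ seg S p b → ∃ λ X′ → X ≡ σ ∷ X′
  replicate-head {suc m} _ _ _ _ (refl ∷ _) _ = _ , refl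
  replicate-head {suc m} {suc _} _ _ first not-first (_ ∷ʳ σᵐ⊆X′) X⊆ with ∷-⊆-seg⁻ S X⊆
  ... | p≤b , X′⊆ =
    ⊥-elim (not-first (FirstWithin-replicate (suc m) p≤b first (⊆-trans σᵐ⊆X′ X′⊆)))

module _ {A : Set} {S : List A} {σ : A} {ℓ : ℕ} {i : ℕ → ℕ}
  (occ : Occurrences S σ ℓ i) (2≤ℓ : 2 ≤ ℓ)
  {Y₀ Y Z₀ Z : List A} {j₁ j₂ : ℕ}
  (Y₀-max : MaxCommonSub Y₀
             (segCO S (i 1) (i (⌊ ℓ /2⌋ + 1))) (seg S (i (⌊ ℓ /2⌋ + 1)) (length S)))
  (σᵉ⊆Y₀ : replicate ⌊ ℓ /2⌋ σ ⊆ Y₀)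
  (Y-def : MaxExtensionIf (IsOdd ℓ) Y₀
             (segCO S (i 1) (i (⌊ ℓ /2⌋ + 2))) (seg S (i (⌊ ℓ /2⌋ + 2)) (length S)) Y)
  (j₁-min : MinEnd Y S (i 1) j₁)
  (Z₀-max : MaxCommonSub Z₀ (seg S 1 j₁) (segOC S j₁ (length S)))
  (Y⊆Z₀ : Y ⊆ Z₀)
  (j₂-min : IsOdd ℓ → MinEnd Y S (i 2) j₂)
  (Z-def : MaxExtensionIf (IsOdd ℓ) Z₀ (seg S 1 j₂) (segOC S j₂ (length S)) Z)
  where

  open OccurrencesProperties {S = S} {σ} {ℓ} {i} occ

  private
    n : ℕ
    n = length S

    e : ℕ
    e = ⌊ ℓ /2⌋

    1≤e : 1 ≤ e
    1≤e = ⌊n/2⌋-mono 2≤ℓ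

    1≤ℓ : 1 ≤ ℓ
    1≤ℓ = ≤-trans (s≤s z≤n) 2≤ℓ

    1≤i₁ : 1 ≤ i 1
    1≤i₁ = i-positive ≤-refl 1≤ℓ

    ℓ≤1+e+e : ℓ ≤ suc (e + e)
    ℓ≤1+e+e = n≤1+⌊n/2⌋+⌊n/2⌋ ℓ

    Y₀⊆Y : Y₀ ⊆ Y
    Y₀⊆Y = MaxExtensionIf-⊇ Y-def

    Z₀⊆Z : Z₀ ⊆ Z
    Z₀⊆Z = MaxExtensionIf-⊇ Z-def

  Y-starts-with-σ : ∃ λ Y′ → Y ≡ σ ∷ Y′
  Y-starts-with-σ with MaxExtensionIf-cases Y-def
  ... | inj₁ (odd , Y-max) =
    replicate-head 1≤e (i-positive (≤-trans 1≤e (m≤m+n e 2)) e+2≤ℓ) (FirstWithin-at e+2≤ℓ) too-many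
      (⊆-trans σᵉ⊆Y₀ Y₀⊆Y) (proj₂ (proj₁ Y-max))
    where
    ℓ≡1+e+e : ℓ ≡ suc (e + e)
    ℓ≡1+e+e = IsOdd⇒≡1+⌊n/2⌋+⌊n/2⌋ odd

    e+2≤ℓ : e + 2 ≤ ℓ
    e+2≤ℓ = subst (e + 2 ≤_) (sym ℓ≡1+e+e)
      (≤-trans (+-monoʳ-≤ e (s≤s 1≤e)) (≤-reflexive (+-suc e e)))

    too-many : ¬ FirstWithin n (e + (e + 2))
    too-many (e+e+2≤ℓ , _) =
      1+n≰n (subst (_≤ suc (e + e)) (trans (sym (+-assoc e e 2)) (+-comm (e + e) 2))
        (≤-trans e+e+2≤ℓ ℓ≤1+e+e))
  ... | inj₂ Y≡Y₀ = map₂ (trans Y≡Y₀)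
    (replicate-head 1≤e 1≤i₁ (FirstWithin-at 1≤ℓ) (¬FirstWithin-pred (m≤n+m 1 e)) σᵉ⊆Y₀
      (⊆-trans (proj₁ (proj₁ Y₀-max)) (segCO-⊆-seg S (i 1) (i (e + 1)))))

  module _ {P R : List A} (Y⊆σR : Y ⊆ σ ∷ R) (Z⊆U : Z ⊆ P ++ σ ∷ R)
    (Z<U : length Z < length (P ++ σ ∷ R)) (sq : AnchoredSquare S P σ R) where

    open AnchoredSquare sq

    private
      σᵉ⊆σR : replicate e σ ⊆ σ ∷ R
      σᵉ⊆σR = ⊆-trans σᵉ⊆Y₀ (⊆-trans Y₀⊆Y Y⊆σR)

      e+α≤β : ∀ {α β} → suc α ≤ ℓ → i (suc α) ≡ suc c → suc β ≤ ℓ → i (suc β) ≡ suc d → e + α ≤ β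
      e+α≤β α<ℓ iα≡ β<ℓ iβ≡ =
        ≤-pred (FirstWithin-< (FirstWithin-replicate e (<⇒≤ (∷-⊆-segOC⇒< S R⊆₁))
                                 (FirstWithin-before α<ℓ iα≡) (⊆-trans σᵉ⊆σR R⊆₁))
                              (s≤s z≤n) β<ℓ (subst (p <_) (sym iβ≡) (s≤s p≤d)))

      e+β≤ℓ : ∀ {β} → suc β ≤ ℓ → i (suc β) ≡ suc d → e + β ≤ ℓ
      e+β≤ℓ β<ℓ iβ≡ =
        proj₁ (FirstWithin-replicate e (<⇒≤ (∷-⊆-segOC⇒< S R⊆₂))
                 (FirstWithin-before β<ℓ iβ≡) (⊆-trans σᵉ⊆σR R⊆₂))

      σR-between : ∀ {t} → i 1 ≤ suc c → i t ≡ suc d →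
        CommonSub (σ ∷ R) (segCO S (i 1) (i t)) (seg S (i t) n)
      σR-between i₁≤ it≡ rewrite it≡ =
        ⊆-trans R⊆₁ (⊆-trans (segOC-⊆ S {a = c} ≤-refl p≤d) (segOC-⊆-segCO S 1≤i₁ i₁≤)) , R⊆₂

      Y≡σR-via : ∀ {t X} → i 1 ≤ suc c → i t ≡ suc d →
        MaxCommonSub X (segCO S (i 1) (i t)) (seg S (i t) n) → X ⊆ Y → Y ≡ σ ∷ R
      Y≡σR-via i₁≤ it≡ X-max X⊆Y = MaxCommonSub-sandwich X-max (σR-between i₁≤ it≡) X⊆Y Y⊆σR

      Y≡σR-odd : IsOdd ℓ → i 1 ≤ suc c → i (e + 2) ≡ suc d → Y ≡ σ ∷ R
      Y≡σR-odd odd i₁≤ it≡ = Y≡σR-via i₁≤ it≡ Y-max ⊆-refl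
        where
        Y-max : MaxCommonSub Y (segCO S (i 1) (i (e + 2))) (seg S (i (e + 2)) n)
        Y-max = MaxExtensionIf-max Y-def odd
          (⊆-trans Y₀⊆Y (⊆-trans Y⊆σR (proj₂ (σR-between i₁≤ it≡))))

      U-common : ∀ {t j} → i t ≡ suc c → MinEnd Y S (i t) j → Y ≡ σ ∷ R →
        CommonSub (P ++ σ ∷ R) (seg S 1 j) (segOC S j n)
      U-common {j = j} it≡ j-min Y≡σR =
        MinEnd-square-commonSub (subst₂ (λ X q → MinEnd X S q j) Y≡σR it≡ j-min)
          P⊆₁ R⊆₁ p≤d P⊆₂ R⊆₂

      U-refutes-Z₀ : Y ≡ σ ∷ R → i 1 ≡ suc c → ⊥
      U-refutes-Z₀ Y≡σR i₁≡ =
        MaxCommonSub-no-longer Z₀-max (⊆-trans Z₀⊆Z Z⊆U) (≤-<-trans (length-mono-≤ Z₀⊆Z) Z<U)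
          (U-common i₁≡ j₁-min Y≡σR)

      U-refutes-Z : IsOdd ℓ → Y ≡ σ ∷ R → i 2 ≡ suc c → ⊥
      U-refutes-Z odd Y≡σR i₂≡ =
        MaxCommonSub-no-longer Z-max Z⊆U Z<U U-common₂
        where
        U-common₂ : CommonSub (P ++ σ ∷ R) (seg S 1 j₂) (segOC S j₂ n)
        U-common₂ = U-common i₂≡ (j₂-min odd) Y≡σR

        Z-max : MaxCommonSub Z (seg S 1 j₂) (segOC S j₂ n)
        Z-max = MaxExtensionIf-max Z-def odd (⊆-trans Z₀⊆Z (⊆-trans Z⊆U (proj₂ U-common₂)))

      odd-offsets-absurd : ∀ {α} → IsOdd ℓ → α ≤ 1 → i (suc α) ≡ suc c → i (e + 2) ≡ suc d → ⊥
      odd-offsets-absurd odd z≤n       i₁≡ ie+2≡ =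
        U-refutes-Z₀ (Y≡σR-odd odd (≤-reflexive i₁≡) ie+2≡) i₁≡
      odd-offsets-absurd odd (s≤s z≤n) i₂≡ ie+2≡ =
        U-refutes-Z odd
          (Y≡σR-odd odd (≤-trans (i-mono ≤-refl (s≤s z≤n) 2≤ℓ) (≤-reflexive i₂≡)) ie+2≡) i₂≡

    anchoredSquare-absurd : ⊥
    anchoredSquare-absurd with index-of-suc x-at₁ | index-of-suc x-at₂
    ... | α , α<ℓ , iα≡ | β , β<ℓ , iβ≡
      with half-offsets (e+α≤β α<ℓ iα≡ β<ℓ iβ≡) (e+β≤ℓ β<ℓ iβ≡) ℓ≤1+e+e
    ... | inj₁ (refl , refl) =
      U-refutes-Z₀ (Y≡σR-via (≤-reflexive iα≡) (trans (cong i (+-comm e 1)) iβ≡) Y₀-max Y₀⊆Y) iα≡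
    ... | inj₂ (ℓ≡1+e+e , refl , α≤1) =
      odd-offsets-absurd (subst IsOdd (sym ℓ≡1+e+e) (IsOdd-1+n+n e)) α≤1 iα≡
        (trans (cong i (+-comm e 2)) iβ≡)

  square-maximal : ∀ {U} → Z ⊆ U → length Z < length U → ¬ (U ++ U ⊆ S)
  square-maximal Z⊆U Z<U UU with Y-starts-with-σ
  ... | Y′ , Y≡σY′ with ⊆-∷-split (subst (_⊆ _) Y≡σY′ (⊆-trans Y⊆Z₀ (⊆-trans Z₀⊆Z Z⊆U)))
  ... | P , R , refl , Y′⊆R =
    anchoredSquare-absurd (subst (_⊆ σ ∷ R) (sym Y≡σY′) (refl ∷ Y′⊆R)) Z⊆U Z<U (anchoredSquare UU)

lemma6 : {A : Set} (S : List A) → EveryCharTwice S →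
    (σ : A) (ℓ : ℕ) (i : ℕ → ℕ) → 2 ≤ ℓ → Occurrences S σ ℓ i →
    (Y₀ : List A) →
    MaxCommonSub Y₀ (segCO S (i 1) (i (⌊ ℓ /2⌋ + 1))) (seg S (i (⌊ ℓ /2⌋ + 1)) (length S)) →
    replicate ⌊ ℓ /2⌋ σ ⊆ Y₀ →
    (Y : List A) →
    ((IsOdd ℓ × (Y₀ ⊆ seg S (i (⌊ ℓ /2⌋ + 2)) (length S)) ×
        MaxCommonSub Y (segCO S (i 1) (i (⌊ ℓ /2⌋ + 2))) (seg S (i (⌊ ℓ /2⌋ + 2)) (length S)) ×
        (Y₀ ⊆ Y))
      ⊎ (¬ (IsOdd ℓ × (Y₀ ⊆ seg S (i (⌊ ℓ /2⌋ + 2)) (length S))) × (Y ≡ Y₀))) →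
    (j₁ : ℕ) → MinEnd Y S (i 1) j₁ →
    (Z₀ : List A) → MaxCommonSub Z₀ (seg S 1 j₁) (segOC S j₁ (length S)) → Y ⊆ Z₀ →
    (j₂ : ℕ) → (IsOdd ℓ → MinEnd Y S (i 2) j₂) →
    (Z : List A) →
    ((IsOdd ℓ × (Z₀ ⊆ segOC S j₂ (length S)) ×
        MaxCommonSub Z (seg S 1 j₂) (segOC S j₂ (length S)) × (Z₀ ⊆ Z))
      ⊎ (¬ (IsOdd ℓ × (Z₀ ⊆ segOC S j₂ (length S))) × (Z ≡ Z₀))) →
    ¬ InnerExtendable S Z
lemma6 S _ σ ℓ i 2≤ℓ occ Y₀ Y₀-max σᵉ⊆Y₀ Y Y-def j₁ j₁-min Z₀ Z₀-max Y⊆Z₀ j₂ j₂-min Z Z-def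
  extendable =
  let U , Z⊆U , Z<U , UU = innerExtendable⇒longer-square extendable
  in square-maximal occ 2≤ℓ Y₀-max σᵉ⊆Y₀ Y-def j₁-min Z₀-max Y⊆Z₀ j₂-min Z-def Z⊆U Z<U UU
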